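{- Let $n\geq r\geq 3$ and let $\mathcal{H}$ be a $2$-connected $r$-graph on $n$ vertices. Suppose $S_1,S_2\subseteq V(\mathcal{H})$ are disjoint vertex sets with $|S_1|\geq 2$ and $|S_2|\geq 2$. Then there exist two disjoint Berge paths between $S_1$ and $S_2$: that is, there are $u_1,u_2\in S_1$, $v_1,v_2\in S_2$ and a Berge path from $u_1$ to $v_1$ and a Berge path from $u_2$ to $v_2$ that share no defining vertices and no defining hyperedges.
   Context: An $r$-graph is a hypergraph all of whose hyperedges are $r$-sets. A Berge path from $u$ to $v$ consists of distinct (defining) vertices $u=w_1,\dots,w_m=v$ and distinct (defining) hyperedges $e_1,\dots,e_{m-1}$ with $\{w_i,w_{i+1}\}\subseteq e_i$. A hypergraph is connected if its vertex set cannot be partitioned into two nonempty parts with no hyperedge meeting both. $\mathcal{H}$ is $2$-connected if it is connected and has neither a cut vertex (a vertex $w$ with $V(\mathcal{H})=\{w\}\cup V_1\cup V_2$, $V_1,V_2$ nonempty and disjoint, every hyperedge contained in $\{w\}\cup V_1$ or $\{w\}\cup V_2$) nor a cut hyperedge (a hyperedge $e$ with $V(\mathcal{H})=V_1\cup V_2$, $V_1,V_2$ nonempty and disjoint, every hyperedge $f\ne e$ contained in $V_1$ or in $V_2$). -}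

module Defs where

open import Data.Nat using (ℕ; suc)
open import Data.Fin using (Fin; zero; suc; inject₁; fromℕ)
open import Data.Fin.Subset using (Subset; _∈_; ∣_∣)
open import Data.Bool using (Bool; true; false)
open import Data.Product using (Σ; ∃; _×_; _,_)
open import Data.Sum using (_⊎_)
open import Relation.Nullary using (¬_)
open import Relation.Binary.PropositionalEquality using (_≡_; _≢_)
open import Function.Definitions using (Injective)

record RGraph (r n : ℕ) : Set where
  field
    m       : ℕ
    edge    : Fin m → Subset n
    edgeInj : Injective _≡_ _≡_ edge
    uniform : ∀ i → ∣ edge i ∣ ≡ r
open RGraph public

module _ {r n : ℕ} (H : RGraph r n) where

  -- a 2-colouring of the vertices: colour true = V₁, false = V₂
  -- edge j lies entirely in one colour class
  Mono : (Fin n → Bool) → Fin (m H) → Set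
  Mono c j = (∀ x → x ∈ edge H j → c x ≡ true) ⊎ (∀ x → x ∈ edge H j → c x ≡ false)

  BothNonempty : (Fin n → Bool) → Set
  BothNonempty c = (∃ λ x → c x ≡ true) × (∃ λ y → c y ≡ false)

  Connected : Set
  Connected = ¬ (Σ (Fin n → Bool) λ c → BothNonempty c × (∀ j → Mono c j))

  CutVertex : Fin n → Set
  CutVertex w = Σ (Fin n → Bool) λ c →
      ((∃ λ x → x ≢ w × c x ≡ true) × (∃ λ y → y ≢ w × c y ≡ false))
    × (∀ j → (∀ x → x ∈ edge H j → x ≢ w → c x ≡ true)
           ⊎ (∀ x → x ∈ edge H j → x ≢ w → c x ≡ false))

  CutEdge : Fin (m H) → Set
  CutEdge e = Σ (Fin n → Bool) λ c → BothNonempty c × (∀ j → j ≢ e → Mono c j)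

  TwoConnected : Set
  TwoConnected = Connected × (∀ w → ¬ CutVertex w) × (∀ e → ¬ CutEdge e)

  record BergePath (u v : Fin n) : Set where
    field
      len    : ℕ
      vtx    : Fin (suc len) → Fin n
      edg    : Fin len → Fin (m H)
      vtxInj : Injective _≡_ _≡_ vtx
      edgInj : Injective _≡_ _≡_ edg
      start  : vtx zero ≡ u
      end    : vtx (fromℕ len) ≡ v
      link   : ∀ i → (vtx (inject₁ i) ∈ edge H (edg i)) × (vtx (suc i) ∈ edge H (edg i))
  open BergePath public

  Disjoint : ∀ {u₁ v₁ u₂ v₂} → BergePath u₁ v₁ → BergePath u₂ v₂ → Set
  Disjoint P Q = (∀ i j → vtx P i ≢ vtx Q j) × (∀ i j → edg P i ≢ edg Q j)

{-# OPTIONS --safe #-}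
-- Let G be the incidence graph of H (its nodes are the vertices and the hyperedges of H, a
-- vertex being joined to the hyperedges containing it) with an extra sink entered from every
-- vertex of S₂. A path of G from a vertex of S₁ to the sink alternates vertices and
-- hyperedges, so it is a Berge path to S₂ followed by the sink, and two such paths meeting
-- only at the sink give two disjoint Berge paths.
--
-- Call a fan at v two paths from S₁ to v meeting only at v; a fan at the sink is grown along
-- a walk. Given a fan at w and an edge w → v, take a walk q from S₁ to v avoiding w and let x
-- be its last node on the fan, say on P₁. Then P₁ up to x followed by q from x, together with
-- P₂ extended by w → v, is a fan at v (if q misses the fan, q and P₁ extended by w → v are).
--
-- The walk q exists by 2-connectivity: otherwise the vertices reachable from a vertex without
-- passing through w, coloured against the others, exhibit w as a cut vertex or a cut
-- hyperedge, or (when w is the sink) show that H is disconnected. As |S₁| ≥ 2 and every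
-- hyperedge has at least two vertices, q can start in S₁ and end with a vertex other than w.
module Submission where

open import Defs
open import Data.Nat using (ℕ; _≤_; _<_; zero; suc; z≤n; s≤s; _+_)
open import Data.Nat.Properties using (+-suc; +-identityʳ; ≤⇒≤′; ≤-trans; n≤1+n; <⇒≱)
open import Data.Nat.Base using (_≤′_; ≤′-refl; ≤′-step)
open import Data.Fin using (Fin; zero; suc)
import Data.Fin.Properties as Finₚ
open import Data.Fin.Subset using (Subset; _∈_; _∉_; ∣_∣; Nonempty; ⁅_⁆)
open import Data.Fin.Subset.Properties
  using (_∈?_; nonempty?; Empty-unique; ∣⊥∣≡0; x∈⁅x⁆; ∣⁅x⁆∣≡1; p⊆q⇒∣p∣≤∣q∣)
import Data.Vec.Functional as Vector
open import Data.Bool using (Bool; true; false)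
open import Data.Unit using (⊤; tt)
import Data.Unit.Properties as ⊤ₚ
open import Data.Product using (Σ; ∃; _×_; _,_)
open import Data.Sum using (_⊎_; inj₁; inj₂; [_,_]; map₁; swap) renaming (map to map⊎)
open import Data.Sum.Properties using (≡-dec; inj₁-injective; inj₂-injective)
open import Data.Empty using (⊥; ⊥-elim)
open import Data.List using (List; []; _∷_; length; map; _++_; allFin)
open import Data.List.Properties using (length-removeAt′)
open import Data.List.Relation.Unary.Any as Any using (Any; here; there; index; _─_; any?)
open import Data.List.Relation.Unary.All as All using (All; [])
open import Data.List.Relation.Unary.AllPairs using ([]; _∷_)
open import Data.List.Relation.Unary.All.Properties using (¬Any⇒All¬)
open import Data.List.Relation.Unary.Unique.Propositional using (Unique)
open import Data.List.Relation.Binary.Subset.Propositional using (_⊆_)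
open import Data.List.Membership.Propositional using () renaming (_∈_ to _∈ₗ_; _∉_ to _∉ₗ_)
open import Data.List.Membership.Propositional.Properties using (∈-map⁺; ∈-++⁺ˡ; ∈-++⁺ʳ; ∈-allFin)
import Data.List.Membership.DecPropositional as DecMembership
open import Function using (id; _∘_; _∋_)
open import Function.Definitions using (Injective)
open import Level using (0ℓ)
open import Relation.Nullary using (¬_; Dec; yes; no; does)
open import Relation.Nullary.Decidable
  using (¬?; _×-dec_; _⊎-dec_; dec-true; dec-false; decidable-stable)
open import Relation.Unary using (Pred; Decidable)
open import Relation.Binary using (Rel; DecidableEquality)
open import Relation.Binary.PropositionalEquality using (_≡_; _≢_; refl; sym; trans; cong; subst)
open import Relation.Binary.Construct.Closure.ReflexiveTransitive using (Star; ε; _◅_; _◅◅_; return)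

0<∣S∣⇒Nonempty : ∀ {n} (S : Subset n) → 0 < ∣ S ∣ → Nonempty S
0<∣S∣⇒Nonempty {n} S 0<∣S∣ with nonempty? S
... | yes S≢∅ = S≢∅
... | no S-empty with subst (0 <_) (trans (cong ∣_∣ (Empty-unique S-empty)) (∣⊥∣≡0 n)) 0<∣S∣
...   | ()

∃-∈-≢ : ∀ {n} (S : Subset n) → 2 ≤ ∣ S ∣ → (y : Fin n) → ∃ λ x → x ∈ S × x ≢ y
∃-∈-≢ S 2≤∣S∣ y with Finₚ.any? (λ x → x ∈? S ×-dec ¬? (x Finₚ.≟ y))
... | yes found = found
... | no none = ⊥-elim (<⇒≱ 2≤∣S∣ (subst (∣ S ∣ ≤_) (∣⁅x⁆∣≡1 y) (p⊆q⇒∣p∣≤∣q∣ S⊆⁅y⁆)))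
  where
    S⊆⁅y⁆ : ∀ {x} → x ∈ S → x ∈ ⁅ y ⁆
    S⊆⁅y⁆ {x} x∈S = subst (_∈ ⁅ y ⁆) (sym x≡y) (x∈⁅x⁆ y)
      where
        x≡y : x ≡ y
        x≡y = decidable-stable (x Finₚ.≟ y) λ x≢y → none (x , x∈S , x≢y)

Injective-∷ : ∀ {A : Set} {k} {x : A} {f : Fin k → A} →
              (∀ i → f i ≢ x) → Injective _≡_ _≡_ f → Injective _≡_ _≡_ (x Vector.∷ f)
Injective-∷ f∌x f-inj {zero}  {zero}  _  = refl
Injective-∷ f∌x f-inj {zero}  {suc j} eq = ⊥-elim (f∌x j (sym eq))
Injective-∷ f∌x f-inj {suc i} {zero}  eq = ⊥-elim (f∌x i eq)
Injective-∷ f∌x f-inj {suc i} {suc j} eq = cong suc (f-inj eq)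

∈-─ : ∀ {A : Set} {x z : A} {ys : List A} → z ∈ₗ ys → (x∈ys : x ∈ₗ ys) → z ≢ x → z ∈ₗ (ys ─ x∈ys)
∈-─ (here refl)  (here refl)  z≢x = ⊥-elim (z≢x refl)
∈-─ (there z∈ys) (here refl)  _   = z∈ys
∈-─ (here refl)  (there x∈ys) _   = here refl
∈-─ (there z∈ys) (there x∈ys) z≢x = there (∈-─ z∈ys x∈ys z≢x)

∈-∉⇒≢ : ∀ {A : Set} {x y : A} {xs : List A} → x ∈ₗ xs → y ∉ₗ xs → x ≢ y
∈-∉⇒≢ x∈xs y∉xs refl = y∉xs x∈xs

Unique-⊆⇒length≤ : ∀ {A : Set} {xs ys : List A} → Unique xs → xs ⊆ ys → length xs ≤ length ys
Unique-⊆⇒length≤ {xs = []} _ _ = z≤n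
Unique-⊆⇒length≤ {xs = x ∷ xs} {ys} (x∉xs ∷ xs-unique) x∷xs⊆ys =
  subst (suc (length xs) ≤_) (sym (length-removeAt′ ys (index x∈ys)))
    (s≤s (Unique-⊆⇒length≤ xs-unique λ z∈xs →
      ∈-─ (x∷xs⊆ys (there z∈xs)) x∈ys (λ z≡x → All.lookup x∉xs z∈xs (sym z≡x))))
  where
    x∈ys : x ∈ₗ ys
    x∈ys = x∷xs⊆ys (here refl)

module Walks {Node : Set} (_≟_ : DecidableEquality Node) (Adj : Rel Node 0ℓ) where
  open DecMembership _≟_ using () renaming (_∈?_ to _∈ₗ?_)

  Walk : Rel Node 0ℓ
  Walk = Star Adj

  nodes : ∀ {u v} → Walk u v → List Node
  nodes {u} ε       = u ∷ []
  nodes {u} (_ ◅ c) = u ∷ nodes c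

  IsPath : ∀ {u v} → Walk u v → Set
  IsPath c = Unique (nodes c)

  snoc : ∀ {u x v} → Walk u x → Adj x v → Walk u v
  snoc c a = c ◅◅ return a

  Avoids : ∀ {u v} → Pred Node 0ℓ → Walk u v → Set
  Avoids C c = ∀ {z} → z ∈ₗ nodes c → ¬ C z

  first∈nodes : ∀ {u v} (c : Walk u v) → u ∈ₗ nodes c
  first∈nodes ε       = here refl
  first∈nodes (_ ◅ _) = here refl

  last∈nodes : ∀ {u v} (c : Walk u v) → v ∈ₗ nodes c
  last∈nodes ε       = here refl
  last∈nodes (_ ◅ c) = there (last∈nodes c)

  ∈-nodes-◅◅ : ∀ {u x v z} (c : Walk u x) (d : Walk x v) →
               z ∈ₗ nodes (c ◅◅ d) → z ∈ₗ nodes c ⊎ z ∈ₗ nodes d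
  ∈-nodes-◅◅ ε       d z∈d          = inj₂ z∈d
  ∈-nodes-◅◅ (_ ◅ c) d (here z≡u)   = inj₁ (here z≡u)
  ∈-nodes-◅◅ (_ ◅ c) d (there z∈cd) = map₁ there (∈-nodes-◅◅ c d z∈cd)

  ∈-nodes-snoc : ∀ {u x v z} (c : Walk u x) (a : Adj x v) →
                 z ∈ₗ nodes (snoc c a) → z ∈ₗ nodes c ⊎ z ≡ v
  ∈-nodes-snoc c a z∈ with ∈-nodes-◅◅ c (return a) z∈
  ... | inj₁ z∈c               = inj₁ z∈c
  ... | inj₂ (here refl)       = inj₁ (last∈nodes c)
  ... | inj₂ (there (here z≡v)) = inj₂ z≡v

  suffixFrom : ∀ {x u v} (c : Walk x v) → u ∈ₗ nodes c →
               Σ (Walk u v) λ s → nodes s ⊆ nodes c × (IsPath c → IsPath s)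
  suffixFrom ε       (here refl)  = ε , id , id
  suffixFrom (a ◅ c) (here refl)  = a ◅ c , id , id
  suffixFrom (_ ◅ c) (there u∈c) with suffixFrom c u∈c
  ... | s , s⊆c , path⇒path = s , there ∘ s⊆c , λ { (_ ∷ c-path) → path⇒path c-path }

  toPath : ∀ {u v} (c : Walk u v) → Σ (Walk u v) λ p → IsPath p × nodes p ⊆ nodes c
  toPath ε = ε , [] ∷ [] , id
  toPath {u} (a ◅ c) with toPath c
  ... | p , p-path , p⊆c with u ∈ₗ? nodes p
  ...   | yes u∈p with suffixFrom p u∈p
  ...     | s , s⊆p , path⇒path = s , path⇒path p-path , there ∘ p⊆c ∘ s⊆p
  toPath {u} (a ◅ c) | p , p-path , p⊆c | no u∉p =
    a ◅ p , ¬Any⇒All¬ _ u∉p ∷ p-path , λ { (here z≡u) → here z≡u ; (there z∈p) → there (p⊆c z∈p) }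

  ∉-nodes-snoc : ∀ {u x v z} (c : Walk u x) (a : Adj x v) →
                 z ∉ₗ nodes c → v ≢ z → z ∉ₗ nodes (snoc c a)
  ∉-nodes-snoc c a z∉c v≢z z∈ = [ z∉c , v≢z ∘ sym ] (∈-nodes-snoc c a z∈)

  prefixTo : ∀ {u v x} (p : Walk u v) → IsPath p → x ∈ₗ nodes p → x ≢ v →
             Σ (Walk u x) λ q → nodes q ⊆ nodes p × v ∉ₗ nodes q
  prefixTo ε       _ (here refl) x≢v = ⊥-elim (x≢v refl)
  prefixTo (_ ◅ p) _ (here refl) x≢v =
    ε , (λ { (here z≡x) → here z≡x ; (there ()) }) , λ { (here v≡x) → x≢v (sym v≡x) ; (there ()) }
  prefixTo (a ◅ p) (u∉p ∷ p-path) (there x∈p) x≢v with prefixTo p p-path x∈p x≢v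
  ... | q , q⊆p , v∉q =
    a ◅ q , (λ { (here z≡u) → here z≡u ; (there z∈q) → there (q⊆p z∈q) }) ,
    λ { (here v≡u) → All.lookup u∉p (last∈nodes p) (sym v≡u) ; (there v∈q) → v∉q v∈q }

  lastVisit : ∀ {C : Pred Node 0ℓ} → Decidable C → ∀ {a v} (q : Walk a v) →
              Avoids C q ⊎
              ∃ λ x → C x × x ∈ₗ nodes q × Σ (Walk x v) λ s → ∀ {z} → z ∈ₗ nodes s → C z → z ≡ x
  lastVisit C? {v = v} ε with C? v
  ... | yes Cv = inj₂ (v , Cv , here refl , ε , λ { (here z≡v) _ → z≡v ; (there ()) _ })
  ... | no ¬Cv = inj₁ λ { (here refl) → ¬Cv ; (there ()) }
  lastVisit C? {a} (adj ◅ q) with lastVisit C? q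
  ... | inj₂ (x , Cx , x∈q , s , s-meets) = inj₂ (x , Cx , there x∈q , s , s-meets)
  ... | inj₁ q-avoids with C? a
  ...   | yes Ca = inj₂ (a , Ca , here refl , adj ◅ q ,
                         λ { (here z≡a) _ → z≡a ; (there z∈q) Cz → ⊥-elim (q-avoids z∈q Cz) })
  ...   | no ¬Ca = inj₁ λ { (here refl) → ¬Ca ; (there z∈q) → q-avoids z∈q }

  module Reachability (Adj? : ∀ x y → Dec (Adj x y)) (enum : List Node) (∈-enum : ∀ z → z ∈ₗ enum)
                      (w u : Node) (u≢w : u ≢ w) where

    ReachIn : ℕ → Pred Node 0ℓ
    ReachIn zero    z = z ≡ u
    ReachIn (suc k) z = ReachIn k z ⊎ (z ≢ w × Any (λ y → ReachIn k y × Adj y z) enum)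

    reachIn? : ∀ k → Decidable (ReachIn k)
    reachIn? zero    z = z ≟ u
    reachIn? (suc k) z =
      reachIn? k z ⊎-dec (¬? (z ≟ w) ×-dec any? (λ y → reachIn? k y ×-dec Adj? y z) enum)

    reachIn-mono : ∀ {j k} → j ≤′ k → ∀ {z} → ReachIn j z → ReachIn k z
    reachIn-mono ≤′-refl        r = r
    reachIn-mono (≤′-step j≤′k) r = inj₁ (reachIn-mono j≤′k r)

    reachIn⇒walk : ∀ k {z} → ReachIn k z → Σ (Walk u z) λ c → w ∉ₗ nodes c
    reachIn⇒walk zero    refl     = ε , λ { (here w≡u) → u≢w (sym w≡u) ; (there ()) }
    reachIn⇒walk (suc k) (inj₁ r) = reachIn⇒walk k r
    reachIn⇒walk (suc k) (inj₂ (z≢w , via)) with Any.satisfied via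
    ... | y , r , adj with reachIn⇒walk k r
    ...   | c , w∉c = snoc c adj , ∉-nodes-snoc c adj w∉c z≢w

    walk⇒reachIn : ∀ {k y z} → ReachIn k y → (c : Walk y z) → w ∉ₗ nodes c →
                   ReachIn (length (nodes c) + k) z
    walk⇒reachIn r ε _ = inj₁ r
    walk⇒reachIn {k} {y} {z} r (_◅_ {j = x} adj c) w∉ =
      subst (λ i → ReachIn i z) (+-suc (length (nodes c)) k)
        (walk⇒reachIn (inj₂ (x≢w , Any.map (λ { refl → r , adj }) (∈-enum y))) c (w∉ ∘ there))
      where
        x≢w : x ≢ w
        x≢w = ∈-∉⇒≢ (first∈nodes c) (w∉ ∘ there)

    Reachable : Pred Node 0ℓ
    Reachable = ReachIn (length enum)

    reachable? : Decidable Reachable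
    reachable? = reachIn? (length enum)

    reachable⇒walk : ∀ {z} → Reachable z → Σ (Walk u z) λ c → w ∉ₗ nodes c
    reachable⇒walk = reachIn⇒walk (length enum)

    -- a path has no more nodes than the graph, so length enum steps suffice
    walk⇒reachable : ∀ {z} (c : Walk u z) → w ∉ₗ nodes c → Reachable z
    walk⇒reachable c w∉c with toPath c
    ... | p , p-path , p⊆c = reachIn-mono (≤⇒≤′ bound) (walk⇒reachIn refl p (w∉c ∘ p⊆c))
      where
        bound : length (nodes p) + 0 ≤ length enum
        bound = subst (_≤ length enum) (sym (+-identityʳ _))
                  (Unique-⊆⇒length≤ p-path λ {z} _ → ∈-enum z)

    reachable-start : Reachable u
    reachable-start = reachIn-mono (≤⇒≤′ z≤n) refl

    reachable-step : ∀ {y z} → Reachable y → Adj y z → z ≢ w → Reachable z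
    reachable-step ry adj z≢w with reachable⇒walk ry
    ... | c , w∉c = walk⇒reachable (snoc c adj) (∉-nodes-snoc c adj w∉c z≢w)

  module Fans (A : Pred Node 0ℓ)
              (reach : ∀ w v → v ≢ w → ∃ λ a → A a × Σ (Walk a v) λ q → w ∉ₗ nodes q) where

    record Fan (v : Node) : Set where
      constructor fan
      field
        a₁ a₂   : Node
        a₁∈A    : A a₁
        a₂∈A    : A a₂
        P₁      : Walk a₁ v
        P₂      : Walk a₂ v
        P₁-path : IsPath P₁
        P₂-path : IsPath P₂
        meet    : ∀ {z} → z ∈ₗ nodes P₁ → z ∈ₗ nodes P₂ → z ≡ v
    open Fan

    fanFromWalks : ∀ {a₁ a₂ v} → A a₁ → A a₂ → (W₁ : Walk a₁ v) (W₂ : Walk a₂ v) →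
                   (∀ {z} → z ∈ₗ nodes W₁ → z ∈ₗ nodes W₂ → z ≡ v) → Fan v
    fanFromWalks a₁∈A a₂∈A W₁ W₂ W-meet with toPath W₁ | toPath W₂
    ... | P₁ , P₁-path , P₁⊆W₁ | P₂ , P₂-path , P₂⊆W₂ =
      fan _ _ a₁∈A a₂∈A P₁ P₂ P₁-path P₂-path λ z∈P₁ z∈P₂ → W-meet (P₁⊆W₁ z∈P₁) (P₂⊆W₂ z∈P₂)

    swapFan : ∀ {v} → Fan v → Fan v
    swapFan F = fan (a₂ F) (a₁ F) (a₂∈A F) (a₁∈A F) (P₂ F) (P₁ F) (P₂-path F) (P₁-path F)
                    λ z∈P₂ z∈P₁ → meet F z∈P₁ z∈P₂

    trivialFan : ∀ {a} → A a → Fan a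
    trivialFan a∈A = fan _ _ a∈A a∈A ε ε ([] ∷ []) ([] ∷ []) λ { (here z≡a) _ → z≡a ; (there ()) _ }

    OnFan : ∀ {v} → Fan v → Pred Node 0ℓ
    OnFan F z = z ∈ₗ nodes (P₁ F) ⊎ z ∈ₗ nodes (P₂ F)

    onFan? : ∀ {v} (F : Fan v) → Decidable (OnFan F)
    onFan? F z = (z ∈ₗ? nodes (P₁ F)) ⊎-dec (z ∈ₗ? nodes (P₂ F))

    viaFreshWalk : ∀ {w v a} (F : Fan w) → Adj w v → A a →
                   (q : Walk a v) → Avoids (OnFan F) q → Fan v
    viaFreshWalk F adj a∈A q q-avoids = fanFromWalks a∈A (a₁∈A F) q (snoc (P₁ F) adj) λ z∈q z∈P₁v →
      [ (λ z∈P₁ → ⊥-elim (q-avoids z∈q (inj₁ z∈P₁))) , id ] (∈-nodes-snoc (P₁ F) adj z∈P₁v)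

    reroute : ∀ {w v x} (F : Fan w) → Adj w v → x ∈ₗ nodes (P₁ F) → x ≢ w →
              (s : Walk x v) → (∀ {z} → z ∈ₗ nodes s → OnFan F z → z ≡ x) → Fan v
    reroute {v = v} F adj x∈P₁ x≢w s s-meets with prefixTo (P₁ F) (P₁-path F) x∈P₁ x≢w
    ... | q , q⊆P₁ , w∉q = fanFromWalks (a₁∈A F) (a₂∈A F) (q ◅◅ s) (snoc (P₂ F) adj) meet′
      where
        meet′ : ∀ {z} → z ∈ₗ nodes (q ◅◅ s) → z ∈ₗ nodes (snoc (P₂ F) adj) → z ≡ v
        meet′ z∈qs z∈P₂v with ∈-nodes-snoc (P₂ F) adj z∈P₂v | ∈-nodes-◅◅ q s z∈qs
        ... | inj₂ z≡v  | _        = z≡v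
        ... | inj₁ z∈P₂ | inj₁ z∈q = ⊥-elim (∈-∉⇒≢ z∈q w∉q (meet F (q⊆P₁ z∈q) z∈P₂))
        ... | inj₁ z∈P₂ | inj₂ z∈s with s-meets z∈s (inj₂ z∈P₂)
        ...   | refl = ⊥-elim (x≢w (meet F x∈P₁ z∈P₂))

    fan-step : ∀ {w v} → Fan w → Adj w v → Fan v
    fan-step {w} {v} F adj with v ≟ w
    ... | yes refl = F
    ... | no v≢w with reach w v v≢w
    ... | a , a∈A , q , w∉q with lastVisit (onFan? F) q
    ... | inj₁ q-avoids = viaFreshWalk F adj a∈A q q-avoids
    ... | inj₂ (x , inj₁ x∈P₁ , x∈q , s , s-meets) = reroute F adj x∈P₁ (∈-∉⇒≢ x∈q w∉q) s s-meets
    ... | inj₂ (x , inj₂ x∈P₂ , x∈q , s , s-meets) =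
      swapFan (reroute (swapFan F) adj x∈P₂ (∈-∉⇒≢ x∈q w∉q) s (λ z∈s → s-meets z∈s ∘ swap))

    fan-along : ∀ {u v} → Fan u → Walk u v → Fan v
    fan-along F ε         = F
    fan-along F (adj ◅ c) = fan-along (fan-step F adj) c

module _ {r n : ℕ} (H : RGraph r n) where

  trivialBergePath : ∀ a → BergePath H a a
  trivialBergePath a = record
    { len = 0 ; vtx = λ _ → a ; edg = Vector.[]
    ; vtxInj = λ { {zero} {zero} _ → refl } ; edgInj = λ { {()} }
    ; start = refl ; end = refl ; link = λ () }

  consBergePath : ∀ {y v} x e (P : BergePath H y v) → x ∈ edge H e → y ∈ edge H e →
                  (∀ i → vtx P i ≢ x) → (∀ i → edg P i ≢ e) → BergePath H x v
  consBergePath x e P x∈e y∈e x∉P e∉P = record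
    { len = suc (len P) ; vtx = x Vector.∷ vtx P ; edg = e Vector.∷ edg P
    ; vtxInj = Injective-∷ x∉P (vtxInj P) ; edgInj = Injective-∷ e∉P (edgInj P)
    ; start = refl ; end = end P
    ; link = λ { zero → x∈e , subst (_∈ edge H e) (sym (start P)) y∈e ; (suc i) → link P i } }

module IncidenceGraph {r n : ℕ} (H : RGraph r n) (S₂ : Subset n) where

  Node : Set
  Node = Fin n ⊎ (Fin (m H) ⊎ ⊤)

  pattern vert x  = inj₁ x
  pattern hedge e = inj₂ (inj₁ e)
  pattern sink    = inj₂ (inj₂ tt)

  _≟ₙ_ : DecidableEquality Node
  _≟ₙ_ = ≡-dec Finₚ._≟_ (≡-dec Finₚ._≟_ ⊤ₚ._≟_)

  -- The sink has no successors, so a walk between two vertices never passes through it.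
  Adj : Rel Node 0ℓ
  Adj (vert x)  (hedge e) = x ∈ edge H e
  Adj (hedge e) (vert x)  = x ∈ edge H e
  Adj (vert x)  sink      = x ∈ S₂
  Adj _         _         = ⊥

  Adj? : ∀ x y → Dec (Adj x y)
  Adj? (vert x)  (vert y)  = no λ ()
  Adj? (vert x)  (hedge e) = x ∈? edge H e
  Adj? (vert x)  sink      = x ∈? S₂
  Adj? (hedge e) (vert x)  = x ∈? edge H e
  Adj? (hedge e) (hedge f) = no λ ()
  Adj? (hedge e) sink      = no λ ()
  Adj? sink      _         = no λ ()

  allNodes : List Node
  allNodes = map inj₁ (allFin n) ++ map (inj₂ ∘ inj₁) (allFin (m H)) ++ sink ∷ []

  ∈-allNodes : ∀ z → z ∈ₗ allNodes
  ∈-allNodes (vert x)  = ∈-++⁺ˡ (∈-map⁺ inj₁ (∈-allFin x))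
  ∈-allNodes (hedge e) = ∈-++⁺ʳ (map inj₁ (allFin n)) (∈-++⁺ˡ (∈-map⁺ (inj₂ ∘ inj₁) (∈-allFin e)))
  ∈-allNodes sink      =
    ∈-++⁺ʳ (map inj₁ (allFin n)) (∈-++⁺ʳ (map (inj₂ ∘ inj₁) (allFin (m H))) (here refl))

  vert≢sink : ∀ {x} → (Node ∋ vert x) ≢ sink
  vert≢sink ()

  hedge≢sink : ∀ {e} → (Node ∋ hedge e) ≢ sink
  hedge≢sink ()

  open Walks _≟ₙ_ Adj public

  module Separation (w : Node) (u : Fin n) (u≢w : vert u ≢ w) where
    open Reachability Adj? allNodes ∈-allNodes w (vert u) u≢w public

    side : Fin n → Bool
    side x = does (reachable? (vert x))

    side-start : side u ≡ true
    side-start = dec-true (reachable? (vert u)) reachable-start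

    side-constant : ∀ j → hedge j ≢ w →
      (∀ x → x ∈ edge H j → vert x ≢ w → side x ≡ true) ⊎
      (∀ x → x ∈ edge H j → vert x ≢ w → side x ≡ false)
    side-constant j j≢w with reachable? (hedge j)
    ... | yes j-reached = inj₁ λ x x∈j x≢w →
      dec-true (reachable? (vert x)) (reachable-step j-reached x∈j x≢w)
    ... | no j-unreached = inj₂ λ x x∈j _ →
      dec-false (reachable? (vert x)) λ x-reached → j-unreached (reachable-step x-reached x∈j j≢w)

    side-mono : ∀ j → hedge j ≢ w → (∀ x → vert x ≢ w) → Mono H side j
    side-mono j j≢w vert≢w = map⊎ (λ f x x∈j → f x x∈j (vert≢w x)) (λ f x x∈j → f x x∈j (vert≢w x))
                                  (side-constant j j≢w)

  unreachable⇒¬TwoConnected : ∀ w {u v} (u≢w : vert u ≢ w) → vert v ≢ w →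
                              ¬ Separation.Reachable w u u≢w (vert v) → ¬ TwoConnected H
  unreachable⇒¬TwoConnected w@(vert y) {u} {v} u≢w v≢w v-unreached (_ , noCutVertex , _) =
    noCutVertex y (side , ((u , u≢y , side-start) , (v , v≢y , v-side)) ,
                   λ j → map⊎ avoid-y avoid-y (side-constant j λ ()))
    where
      open Separation w u u≢w
      u≢y : u ≢ y
      u≢y u≡y = u≢w (cong inj₁ u≡y)
      v≢y : v ≢ y
      v≢y v≡y = v≢w (cong inj₁ v≡y)
      v-side : side v ≡ false
      v-side = dec-false (reachable? (vert v)) v-unreached
      avoid-y : ∀ {j b} → (∀ x → x ∈ edge H j → vert x ≢ w → side x ≡ b) →
                ∀ x → x ∈ edge H j → x ≢ y → side x ≡ b
      avoid-y f x x∈j x≢y = f x x∈j (x≢y ∘ inj₁-injective)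
  unreachable⇒¬TwoConnected (hedge e) {u} {v} u≢w v≢w v-unreached (_ , _ , noCutEdge) =
    noCutEdge e (side , ((u , side-start) , (v , dec-false (reachable? (vert v)) v-unreached)) ,
                 λ j j≢e → side-mono j (j≢e ∘ inj₁-injective ∘ inj₂-injective) λ _ ())
    where open Separation (hedge e) u u≢w
  unreachable⇒¬TwoConnected sink {u} {v} u≢w v≢w v-unreached (connected , _ , _) =
    connected (side , ((u , side-start) , (v , dec-false (reachable? (vert v)) v-unreached)) ,
               λ j → side-mono j (λ ()) λ _ ())
    where open Separation sink u u≢w

  walk-avoiding : TwoConnected H → ∀ w {u v} → vert u ≢ w → vert v ≢ w →
                  Σ (Walk (vert u) (vert v)) λ c → w ∉ₗ nodes c
  walk-avoiding 2-conn w {u} {v} u≢w v≢w with Separation.reachable? w u u≢w (vert v)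
  ... | yes v-reached  = Separation.reachable⇒walk w u u≢w v-reached
  ... | no v-unreached = ⊥-elim (unreachable⇒¬TwoConnected w u≢w v≢w v-unreached 2-conn)

  vertex-avoiding : (S : Subset n) → 2 ≤ ∣ S ∣ → (w : Node) → ∃ λ x → x ∈ S × vert x ≢ w
  vertex-avoiding S 2≤∣S∣ (vert y) with ∃-∈-≢ S 2≤∣S∣ y
  ... | x , x∈S , x≢y = x , x∈S , x≢y ∘ inj₁-injective
  vertex-avoiding S 2≤∣S∣ (inj₂ _) with 0<∣S∣⇒Nonempty S (≤-trans (s≤s z≤n) 2≤∣S∣)
  ... | x , x∈S = x , x∈S , λ ()

  Along : ∀ {a b} → BergePath H a b → ∀ {x y} → Walk x y → Set
  Along P c = (∀ i → vert (vtx P i) ∈ₗ nodes c) × (∀ i → hedge (edg P i) ∈ₗ nodes c)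

  pathToSink⇒BergePath : ∀ {a} (p : Walk (vert a) sink) → IsPath p →
                         ∃ λ b → b ∈ S₂ × Σ (BergePath H a b) λ P → Along P p
  pathToSink⇒BergePath {a} (_◅_ {j = sink} a∈S₂ _) _ =
    a , a∈S₂ , trivialBergePath H a , (λ _ → here refl) , λ ()
  pathToSink⇒BergePath {a} (_◅_ {j = hedge e} a∈e (_◅_ {j = vert x} x∈e p)) (a∉p ∷ e∉p ∷ p-path)
    with pathToSink⇒BergePath p p-path
  ... | b , b∈S₂ , P , P-vtx , P-edg =
    b , b∈S₂ , consBergePath H a e P a∈e x∈e a∉P e∉P , vtx-along , edg-along
    where
      a∉P : ∀ i → vtx P i ≢ a
      a∉P i vtx≡a = All.lookup a∉p (there (P-vtx i)) (cong inj₁ (sym vtx≡a))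
      e∉P : ∀ i → edg P i ≢ e
      e∉P i edg≡e = All.lookup e∉p (P-edg i) (cong (inj₂ ∘ inj₁) (sym edg≡e))
      vtx-along : ∀ i → vert ((a Vector.∷ vtx P) i) ∈ₗ (vert a ∷ hedge e ∷ nodes p)
      vtx-along zero    = here refl
      vtx-along (suc i) = there (there (P-vtx i))
      edg-along : ∀ i → hedge ((e Vector.∷ edg P) i) ∈ₗ (vert a ∷ hedge e ∷ nodes p)
      edg-along zero    = there (here refl)
      edg-along (suc i) = there (there (P-edg i))

TwoDisjointBergePaths : ∀ {r n} → RGraph r n → Subset n → Subset n → Set
TwoDisjointBergePaths {n = n} H S₁ S₂ =
  Σ (Fin n) λ u₁ → Σ (Fin n) λ u₂ → Σ (Fin n) λ v₁ → Σ (Fin n) λ v₂ →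
  u₁ ∈ S₁ × u₂ ∈ S₁ × v₁ ∈ S₂ × v₂ ∈ S₂ ×
  Σ (BergePath H u₁ v₁) λ P → Σ (BergePath H u₂ v₂) λ Q → Disjoint H P Q

module _ {r n : ℕ} (H : RGraph r n) (S₁ S₂ : Subset n) (2-conn : TwoConnected H)
         (2≤∣S₁∣ : 2 ≤ ∣ S₁ ∣) (2≤∣S₂∣ : 2 ≤ ∣ S₂ ∣) (2≤∣e∣ : ∀ e → 2 ≤ ∣ edge H e ∣) where
  open IncidenceGraph H S₂

  InS₁ : Pred Node 0ℓ
  InS₁ (vert x) = x ∈ S₁
  InS₁ (inj₂ _) = ⊥

  reach-avoiding : ∀ w v → v ≢ w → ∃ λ a → InS₁ a × Σ (Walk a v) λ q → w ∉ₗ nodes q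
  reach-avoiding w v v≢w with vertex-avoiding S₁ 2≤∣S₁∣ w
  ... | a , a∈S₁ , a≢w = vert a , a∈S₁ , walk-to v v≢w
    where
      via : ∀ {v} (S : Subset n) → 2 ≤ ∣ S ∣ → (∀ {x} → x ∈ S → Adj (vert x) v) → v ≢ w →
            Σ (Walk (vert a) v) λ q → w ∉ₗ nodes q
      via S 2≤∣S∣ S⇒adj v≢w with vertex-avoiding S 2≤∣S∣ w
      ... | x , x∈S , x≢w with walk-avoiding 2-conn w a≢w x≢w
      ...   | c , w∉c = snoc c (S⇒adj x∈S) , ∉-nodes-snoc c (S⇒adj x∈S) w∉c v≢w

      walk-to : ∀ v → v ≢ w → Σ (Walk (vert a) v) λ q → w ∉ₗ nodes q
      walk-to (vert x)  = walk-avoiding 2-conn w a≢w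
      walk-to (hedge e) = via (edge H e) (2≤∣e∣ e) id
      walk-to sink      = via S₂ 2≤∣S₂∣ id

  open Fans InS₁ reach-avoiding

  -- Only the walk from S₁ to the sink matters here; the avoided node is arbitrary.
  fanAtSink : Fan sink
  fanAtSink with 0<∣S∣⇒Nonempty S₁ (≤-trans (s≤s z≤n) 2≤∣S₁∣)
  ... | a , _ with reach-avoiding (vert a) sink (λ ())
  ...   | _ , a′∈S₁ , q , _ = fan-along (trivialFan a′∈S₁) q

  fan⇒TwoDisjointBergePaths : Fan sink → TwoDisjointBergePaths H S₁ S₂
  fan⇒TwoDisjointBergePaths (fan (vert u₁) (vert u₂) u₁∈S₁ u₂∈S₁ P₁ P₂ P₁-path P₂-path meet)
    with pathToSink⇒BergePath P₁ P₁-path | pathToSink⇒BergePath P₂ P₂-path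
  ... | v₁ , v₁∈S₂ , B₁ , B₁-vtx , B₁-edg | v₂ , v₂∈S₂ , B₂ , B₂-vtx , B₂-edg =
    u₁ , u₂ , v₁ , v₂ , u₁∈S₁ , u₂∈S₁ , v₁∈S₂ , v₂∈S₂ , B₁ , B₂ ,
    (λ i j vtx≡ → vert≢sink
                    (meet (B₁-vtx i) (subst (λ x → vert x ∈ₗ nodes P₂) (sym vtx≡) (B₂-vtx j)))) ,
    (λ i j edg≡ → hedge≢sink
                    (meet (B₁-edg i) (subst (λ e → hedge e ∈ₗ nodes P₂) (sym edg≡) (B₂-edg j))))

  twoDisjointBergePaths : TwoDisjointBergePaths H S₁ S₂
  twoDisjointBergePaths = fan⇒TwoDisjointBergePaths fanAtSink

lemma2p14 : (n r : ℕ) → 3 ≤ r → r ≤ n → (H : RGraph r n) → TwoConnected H →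
    (S₁ S₂ : Subset n) → (∀ x → x ∈ S₁ → x ∉ S₂) → 2 ≤ ∣ S₁ ∣ → 2 ≤ ∣ S₂ ∣ →
    Σ (Fin n) λ u₁ → Σ (Fin n) λ u₂ → Σ (Fin n) λ v₁ → Σ (Fin n) λ v₂ →
      u₁ ∈ S₁ × u₂ ∈ S₁ × v₁ ∈ S₂ × v₂ ∈ S₂ ×
      Σ (BergePath H u₁ v₁) λ P → Σ (BergePath H u₂ v₂) λ Q → Disjoint H P Q
lemma2p14 n r 3≤r _ H 2-conn S₁ S₂ _ 2≤∣S₁∣ 2≤∣S₂∣ =
  twoDisjointBergePaths H S₁ S₂ 2-conn 2≤∣S₁∣ 2≤∣S₂∣ 2≤∣e∣
  where
    2≤∣e∣ : ∀ e → 2 ≤ ∣ edge H e ∣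
    2≤∣e∣ e = subst (2 ≤_) (sym (uniform H e)) (≤-trans (n≤1+n 2) 3≤r)
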